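{- Let $q$ be an odd power of $2$, let $\mathrm{Tr}:\mathbb{F}_q\to\mathbb{F}_2$ be the absolute trace, and let $\perp$ be the pseudo polarity of $\mathrm{PG}(2,q)$ mapping the point $P=(x_1,x_2,x_3)$ to the line $P^\perp: x_1X_1 + x_3X_2 + x_2X_3 = 0$. Then there exists a maximal arc $\mathcal{A}$ of Denniston type of degree $\sqrt{q/2}$ in $\mathrm{PG}(2,q)$ such that for every point $P \in \mathcal{A}$, the line $P^\perp$ contains no point of $\mathcal{A}$.
   Context: A maximal arc of degree $n$ in $\mathrm{PG}(2,q)$ is a set of $(n-1)q+n$ points such that every line meets it in $0$ or $n$ points. Maximal arcs of Denniston type are constructed as follows: fix $\alpha\in\mathbb{F}_q$ with $\mathrm{Tr}(\alpha)=1$ and, for $\mu\in\mathbb{F}_q$, let $\mathcal{C}_\mu$ be the set of points satisfying $X_2^2+X_2X_3+\alpha X_3^2+\mu X_1^2=0$; for an additive subgroup $A$ of $\mathbb{F}_q$ of order $n$, the union $\bigcup_{\mu\in A}\mathcal{C}_\mu$ is a maximal arc of degree $n$ (a Denniston maximal arc). -}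

module Defs where

open import Level using (0ℓ)
open import Algebra.Bundles using (CommutativeRing)
open import Data.Nat using (ℕ; zero; suc)
import Data.Nat as ℕ
open import Data.List using (List; length)
open import Data.List.Relation.Unary.Any using (Any)
open import Data.List.Relation.Unary.AllPairs using (AllPairs)
open import Data.Product using (Σ; _×_; ∃)
open import Relation.Nullary using (¬_)
open import Relation.Binary.PropositionalEquality using (_≡_)

-- A finite field of order 2^h (hence isomorphic to GF(2^h)):
-- a commutative ring with 1 ≠ 0 in which every nonzero element is
-- invertible, of characteristic 2, whose carrier is enumerated (up to ≈)
-- by a duplicate-free list of length 2^h.
record FiniteField2 (h : ℕ) : Set₁ where
  field
    cring : CommutativeRing 0ℓ 0ℓ
  open CommutativeRing cring public
  field
    1≉0      : ¬ (1# ≈ 0#)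
    inverse  : ∀ x → ¬ (x ≈ 0#) → ∃ λ y → (x * y) ≈ 1#
    char2    : (1# + 1#) ≈ 0#
    elements : List Carrier
    complete : ∀ x → Any (x ≈_) elements
    distinct : AllPairs (λ x y → ¬ (x ≈ y)) elements
    size     : length elements ≡ 2 ℕ.^ h

module _ {h : ℕ} (F : FiniteField2 h) where
  open FiniteField2 F

  Tr-aux : ℕ → Carrier → Carrier
  Tr-aux zero    y = 0#
  Tr-aux (suc i) y = y + Tr-aux i (y * y)

  Tr : Carrier → Carrier
  Tr x = Tr-aux h x

  _∈ₗ_ : Carrier → List Carrier → Set
  x ∈ₗ A = Any (x ≈_) A

  IsAdditiveSubgroupOfOrder : List Carrier → ℕ → Set
  IsAdditiveSubgroupOfOrder A n =
    AllPairs (λ x y → ¬ (x ≈ y)) A × length A ≡ n ×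
    (0# ∈ₗ A) × (∀ x y → x ∈ₗ A → y ∈ₗ A → (x + y) ∈ₗ A) ×
    (∀ x → x ∈ₗ A → (- x) ∈ₗ A)

  -- homogeneous coordinates (x1,x2,x3) of a point of PG(2,q)
  Triple : Set
  Triple = Carrier × Carrier × Carrier

  NonZeroTriple : Triple → Set
  NonZeroTriple (x₁ Data.Product., x₂ Data.Product., x₃) =
    ¬ ((x₁ ≈ 0#) × (x₂ ≈ 0#) × (x₃ ≈ 0#))

  OnConic : Carrier → Carrier → Triple → Set
  OnConic α μ (x₁ Data.Product., x₂ Data.Product., x₃) =
    ((x₂ * x₂) + (x₂ * x₃) + (α * (x₃ * x₃)) + (μ * (x₁ * x₁))) ≈ 0#

  InDenniston : Carrier → List Carrier → Triple → Set
  InDenniston α A P = Σ Carrier λ μ → μ ∈ₗ A × OnConic α μ P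

  OnPerp : Triple → Triple → Set
  OnPerp (x₁ Data.Product., x₂ Data.Product., x₃) (y₁ Data.Product., y₂ Data.Product., y₃) =
    ((x₁ * y₁) + (x₃ * y₂) + (x₂ * y₃)) ≈ 0#

{-# OPTIONS --safe #-}
-- Since h = 2k + 1 is odd, Tr(1) = 1, and we take α = 1. By Fermat (x^q = x) Tr(x²) = Tr(x), so
-- Tr takes only the values 0 and 1 and the trace form Tr(xy) is a symmetric F₂-bilinear form.
-- Hence j + 1 conditions Tr(u x) = 0 have at least q / 2^(j+1) common solutions, more than 2^j
-- when j < k. Adjoining, one at a time, a new solution orthogonal to 1 and to the elements chosen
-- so far (orthogonality to 1 gives Tr(v²) = Tr(v) = 0) yields an additive subgroup A of order 2^k
-- with Tr(μν) = 0 for all μ, ν ∈ A.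
-- On the other hand, if P ∈ C_μ, Q ∈ C_ν and Q ∈ P^⊥, then x₁ y₁ ≠ 0 and the multiplicativity
-- of the norm form N(a, b) = a² + ab + αb² gives μν = f² + f + α for some f, so Tr(μν) = Tr(α) = 1.
module Submission where

open import Defs
open import Algebra.Bundles using (CommutativeRing)
open import Data.Nat using (ℕ; zero; suc; _≤_; _<_)
import Data.Nat as ℕ
import Data.Nat.Properties as ℕ
open import Data.List using (List; []; _∷_; _++_; length; map; filter; foldr)
open import Data.List.Properties using (length-map; length-++; ++-identityʳ; filter-all)
open import Data.List.Relation.Unary.All as All using (All; []; _∷_; all?)
open import Data.List.Relation.Unary.AllPairs using ([]; _∷_)
open import Data.List.Relation.Unary.Any using (here; there; any?)
open import Data.Product using (Σ; ∃; _×_; _,_; proj₁; proj₂)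
open import Data.Sum using (_⊎_; inj₁; inj₂)
open import Relation.Binary.Bundles using (Setoid)
open import Relation.Binary.Definitions using (Decidable)
open import Relation.Binary.PropositionalEquality as ≡ using (_≡_)
open import Relation.Nullary using (¬_; Dec; yes; no; contradiction)
open import Relation.Nullary.Decidable using (¬?; decidable-stable)
import Relation.Unary
import Algebra.Properties.CommutativeSemigroup as CommutativeSemigroupProperties
import Algebra.Properties.CommutativeSemiring.Exp as CommutativeSemiringExp
import Algebra.Properties.Group as GroupProperties
import Algebra.Properties.Semiring.Exp as Exp
import Algebra.Solver.Ring.NaturalCoefficients.Default as NaturalSolver
import Data.List.Membership.Setoid as Membership
import Data.List.Membership.Setoid.Properties as MembershipProps
import Data.List.Relation.Binary.Permutation.Setoid as Permutation
import Data.List.Relation.Binary.Permutation.Setoid.Properties as PermutationProps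
import Data.List.Relation.Binary.Subset.Setoid as Subset
import Data.List.Relation.Unary.Unique.Setoid as UniqueSetoid
import Data.List.Relation.Unary.Unique.Setoid.Properties as UniqueProps
import Relation.Binary.Reasoning.Setoid as SetoidReasoning

module _ {c ℓ} (S : Setoid c ℓ) where
  open Setoid S
  open Membership S using (_∈_; _∉_; find; lose)
  open MembershipProps using (∈-∃++; ∈-resp-≈; ∉-resp-≈; ∈-resp-≋; All[≉]⇒∉)
  open Permutation S using (_↭_; ↭-refl; ↭-prep; ↭-trans; ↭-reflexive-≋)
  open PermutationProps S using (shift; xs↭ys⇒|xs|≡|ys|)
  open Subset S using (_⊆_)
  open UniqueSetoid S using (Unique)

  ∈-dropMiddle : ∀ as {bs x w} → x ∈ as ++ w ∷ bs → ¬ x ≈ w → x ∈ as ++ bs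
  ∈-dropMiddle []       (here x≈w) x≉w = contradiction x≈w x≉w
  ∈-dropMiddle []       (there x∈bs) _ = x∈bs
  ∈-dropMiddle (a ∷ as) (here x≈a) _ = here x≈a
  ∈-dropMiddle (a ∷ as) (there x∈) x≉w = there (∈-dropMiddle as x∈ x≉w)

  Unique-⊆⇒↭-++ : ∀ {xs ys} → Unique xs → xs ⊆ ys → ∃ λ zs → ys ↭ xs ++ zs
  Unique-⊆⇒↭-++ {[]} {ys} _ _ = ys , ↭-refl
  Unique-⊆⇒↭-++ {x ∷ xs} {ys} (x≉xs ∷ !xs) x∷xs⊆ys
    with as , bs , w , x≈w , ys≋ ← ∈-∃++ S (x∷xs⊆ys (here refl))
    with zs , as++bs↭xs++zs ← Unique-⊆⇒↭-++ !xs (λ z∈xs →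
      ∈-dropMiddle as (∈-resp-≋ S ys≋ (x∷xs⊆ys (there z∈xs)))
        λ z≈w → All[≉]⇒∉ S x≉xs (∈-resp-≈ S (trans z≈w (sym x≈w)) z∈xs))
    = zs , ↭-trans (↭-reflexive-≋ ys≋) (↭-trans (shift (sym x≈w) as bs) (↭-prep x as++bs↭xs++zs))

  Unique-⊆⇒length≤ : ∀ {xs ys} → Unique xs → xs ⊆ ys → length xs ≤ length ys
  Unique-⊆⇒length≤ {xs} {ys} !xs xs⊆ys with zs , ys↭xs++zs ← Unique-⊆⇒↭-++ !xs xs⊆ys =
    ≡.subst (length xs ≤_) (≡.sym (≡.trans (xs↭ys⇒|xs|≡|ys| ys↭xs++zs) (length-++ xs)))
      (ℕ.m≤m+n (length xs) (length zs))

  Unique-⊆-length≡⇒↭ : ∀ {xs ys} → Unique xs → length xs ≡ length ys → xs ⊆ ys → ys ↭ xs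
  Unique-⊆-length≡⇒↭ {xs} {ys} !xs |xs|≡|ys| xs⊆ys with Unique-⊆⇒↭-++ !xs xs⊆ys
  ... | [] , ys↭xs++[] = ≡.subst (ys ↭_) (++-identityʳ xs) ys↭xs++[]
  ... | z ∷ zs , ys↭xs++z∷zs = contradiction
    (≡.trans (≡.sym (length-++ xs)) (≡.trans (≡.sym (xs↭ys⇒|xs|≡|ys| ys↭xs++z∷zs)) (≡.sym |xs|≡|ys|)))
    (ℕ.m+1+n≢m (length xs))

  Unique-∈⇒Dec≈ : ∀ {xs x y} → Unique xs → x ∈ xs → y ∈ xs → Dec (x ≈ y)
  Unique-∈⇒Dec≈ (_ ∷ _) (here x≈z) (here y≈z) = yes (trans x≈z (sym y≈z))
  Unique-∈⇒Dec≈ (z≉xs ∷ _) (here x≈z) (there y∈xs) =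
    no λ x≈y → All[≉]⇒∉ S z≉xs (∈-resp-≈ S (trans (sym x≈y) x≈z) y∈xs)
  Unique-∈⇒Dec≈ (z≉xs ∷ _) (there x∈xs) (here y≈z) =
    no λ x≈y → All[≉]⇒∉ S z≉xs (∈-resp-≈ S (trans x≈y y≈z) x∈xs)
  Unique-∈⇒Dec≈ (_ ∷ !xs) (there x∈xs) (there y∈xs) = Unique-∈⇒Dec≈ !xs x∈xs y∈xs

  enumeration⇒decidable : ∀ {xs} → Unique xs → (∀ x → x ∈ xs) → Decidable _≈_
  enumeration⇒decidable !xs complete x y = Unique-∈⇒Dec≈ !xs (complete x) (complete y)

  longer⇒∃∉ : Decidable _≈_ → ∀ {xs ys} → Unique xs → length ys < length xs →
              ∃ λ x → x ∈ xs × x ∉ ys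
  longer⇒∃∉ _≟_ {xs} {ys} !xs |ys|<|xs| with any? (λ x → ¬? (any? (x ≟_) ys)) xs
  ... | yes some∉ = find some∉
  ... | no none∉ = contradiction (Unique-⊆⇒length≤ !xs xs⊆ys) (ℕ.<⇒≱ |ys|<|xs|)
    where
    xs⊆ys : xs ⊆ ys
    xs⊆ys {x} x∈xs = decidable-stable (any? (x ≟_) ys) λ x∉ys → none∉ (lose (∉-resp-≈ S) x∈xs x∉ys)

module NormForm {c ℓ} (R : CommutativeRing c ℓ) where
  open CommutativeRing R
  open NaturalSolver commutativeSemiring using (solve; _:=_; _:+_; _:*_)

  norm : Carrier → Carrier → Carrier → Carrier
  norm α a b = a * a + a * b + α * (b * b)

  norm-cong : ∀ α {a a′ b b′} → a ≈ a′ → b ≈ b′ → norm α a b ≈ norm α a′ b′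
  norm-cong α a≈a′ b≈b′ = +-cong (+-cong (*-cong a≈a′ a≈a′) (*-cong a≈a′ b≈b′)) (*-congˡ (*-cong b≈b′ b≈b′))

  norm-scale : ∀ α a b r → norm α a b * (r * r) ≈ norm α (a * r) (b * r)
  norm-scale = solve 4 (λ α a b r →
    (a :* a :+ a :* b :+ α :* (b :* b)) :* (r :* r)
      := (a :* r) :* (a :* r) :+ (a :* r) :* (b :* r) :+ α :* ((b :* r) :* (b :* r))) refl

module _ {c ℓ} (R : CommutativeRing c ℓ) where
  open CommutativeRing R
  open NormForm R using (norm)
  open NaturalSolver commutativeSemiring using (solve; _:=_; _:+_; _:*_)

  module Characteristic2 (1+1≈0 : 1# + 1# ≈ 0#) where
    open SetoidReasoning setoid
    open GroupProperties +-group using (inverseˡ-unique)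
    open CommutativeSemigroupProperties +-commutativeSemigroup using (interchange)

    x+x≈0 : ∀ x → x + x ≈ 0#
    x+x≈0 x = begin
      x + x            ≈⟨ +-cong (*-identityʳ x) (*-identityʳ x) ⟨
      x * 1# + x * 1#  ≈⟨ distribˡ x 1# 1# ⟨
      x * (1# + 1#)    ≈⟨ *-congˡ 1+1≈0 ⟩
      x * 0#           ≈⟨ zeroʳ x ⟩
      0#               ∎

    -x≈x : ∀ x → - x ≈ x
    -x≈x x = sym (inverseˡ-unique x x (x+x≈0 x))

    x+y≈0⇒x≈y : ∀ {x y} → x + y ≈ 0# → x ≈ y
    x+y≈0⇒x≈y {x} {y} x+y≈0 = trans (inverseˡ-unique x y x+y≈0) (-x≈x y)

    x+[x+y]≈y : ∀ x y → x + (x + y) ≈ y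
    x+[x+y]≈y x y = begin
      x + (x + y)  ≈⟨ +-assoc x x y ⟨
      (x + x) + y  ≈⟨ +-congʳ (x+x≈0 x) ⟩
      0# + y       ≈⟨ +-identityˡ y ⟩
      y            ∎

    [x+y]+[x+z]≈y+z : ∀ x y z → (x + y) + (x + z) ≈ y + z
    [x+y]+[x+z]≈y+z x y z = begin
      (x + y) + (x + z)  ≈⟨ interchange x y x z ⟩
      (x + x) + (y + z)  ≈⟨ +-congʳ (x+x≈0 x) ⟩
      0# + (y + z)       ≈⟨ +-identityˡ (y + z) ⟩
      y + z              ∎

    [x+y]²≈x²+y² : ∀ x y → (x + y) * (x + y) ≈ x * x + y * y
    [x+y]²≈x²+y² x y = begin
      (x + y) * (x + y)                     ≈⟨ expand x y ⟩
      x * x + y * y + (x * y + x * y)       ≈⟨ +-congˡ (x+x≈0 (x * y)) ⟩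
      x * x + y * y + 0#                    ≈⟨ +-identityʳ _ ⟩
      x * x + y * y                         ∎
      where
      expand : ∀ x y → (x + y) * (x + y) ≈ x * x + y * y + (x * y + x * y)
      expand = solve 2 (λ x y → (x :+ y) :* (x :+ y) := x :* x :+ y :* y :+ (x :* y :+ x :* y)) refl

    -- N(a , b) = norm α a b is the norm of a + bω for ω² + ω + α = 0; the identity is
    -- multiplicativity of the norm applied to (a + bω)(c + dω̄), where ω̄ = ω + 1.
    norm-product : ∀ α a b c d →
      norm α a b * norm α c d ≈ norm α (a * c + a * d + α * (b * d)) (a * d + b * c)
    norm-product α a b c d = begin
      norm α a b * norm α c d            ≈⟨ +-identityʳ _ ⟨
      norm α a b * norm α c d + 0#       ≈⟨ +-congˡ (x+x≈0 X) ⟨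
      norm α a b * norm α c d + (X + X)  ≈⟨ over-ℤ ⟩
      norm α (a * c + a * d + α * (b * d)) (a * d + b * c) ∎
      where
      X : Carrier
      X = a * a * (d * d) + a * a * (c * d) + α * (a * b * (c * d) + a * b * (c * d)) + α * (a * b * (d * d))
      -- over ℤ the two sides differ by the even term X + X
      over-ℤ : norm α a b * norm α c d + (X + X) ≈ norm α (a * c + a * d + α * (b * d)) (a * d + b * c)
      over-ℤ = solve 5 (λ α a b c d →
        let X = a :* a :* (d :* d) :+ a :* a :* (c :* d)
                  :+ α :* (a :* b :* (c :* d) :+ a :* b :* (c :* d)) :+ α :* (a :* b :* (d :* d))
            e = a :* c :+ a :* d :+ α :* (b :* d)
            s = a :* d :+ b :* c
        in (a :* a :+ a :* b :+ α :* (b :* b)) :* (c :* c :+ c :* d :+ α :* (d :* d)) :+ (X :+ X)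
             := e :* e :+ e :* s :+ α :* (s :* s)) refl α a b c d

module FiniteField2Properties {h : ℕ} (F : FiniteField2 h) where
  open FiniteField2 F
  open Characteristic2 cring char2
  open SetoidReasoning setoid
  open Exp semiring using (_^_; ^-congʳ)
  open Membership setoid using (_∈_)
  open MembershipProps using (∈-filter⁺; ∈-filter⁻; ∈-map⁻)
  open Permutation setoid using (_↭_)
  open UniqueSetoid setoid using (Unique)

  infix 4 _≟_
  _≟_ : Decidable _≈_
  _≟_ = enumeration⇒decidable setoid distinct complete

  x*y≈0⇒y≈0 : ∀ {x y} → ¬ x ≈ 0# → x * y ≈ 0# → y ≈ 0#
  x*y≈0⇒y≈0 {x} {y} x≉0 xy≈0 with x⁻¹ , xx⁻¹≈1 ← inverse x x≉0 = begin
    y               ≈⟨ *-identityˡ y ⟨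
    1# * y          ≈⟨ *-congʳ (trans (sym xx⁻¹≈1) (*-comm x x⁻¹)) ⟩
    x⁻¹ * x * y     ≈⟨ *-assoc x⁻¹ x y ⟩
    x⁻¹ * (x * y)   ≈⟨ *-congˡ xy≈0 ⟩
    x⁻¹ * 0#        ≈⟨ zeroʳ x⁻¹ ⟩
    0#              ∎

  x*y≉0 : ∀ {x y} → ¬ x ≈ 0# → ¬ y ≈ 0# → ¬ x * y ≈ 0#
  x*y≉0 x≉0 y≉0 xy≈0 = y≉0 (x*y≈0⇒y≈0 x≉0 xy≈0)

  x*x≈0⇒x≈0 : ∀ {x} → x * x ≈ 0# → x ≈ 0#
  x*x≈0⇒x≈0 {x} x*x≈0 with x ≟ 0#
  ... | yes x≈0 = x≈0
  ... | no x≉0 = x*y≈0⇒y≈0 x≉0 x*x≈0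

  *-cancelˡ-≉0 : ∀ {x y z} → ¬ x ≈ 0# → x * y ≈ x * z → y ≈ z
  *-cancelˡ-≉0 {x} {y} {z} x≉0 xy≈xz = x+y≈0⇒x≈y (x*y≈0⇒y≈0 x≉0 (begin
    x * (y + z)    ≈⟨ distribˡ x y z ⟩
    x * y + x * z  ≈⟨ +-congʳ xy≈xz ⟩
    x * z + x * z  ≈⟨ x+x≈0 (x * z) ⟩
    0#             ∎))

  ≉0? : ∀ x → Dec (¬ x ≈ 0#)
  ≉0? x = ¬? (x ≟ 0#)

  ≉0-resp-≈ : ∀ {x y} → x ≈ y → ¬ x ≈ 0# → ¬ y ≈ 0#
  ≉0-resp-≈ x≈y x≉0 y≈0 = x≉0 (trans x≈y y≈0)

  nonzero : List Carrier
  nonzero = filter ≉0? elements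

  ∈-nonzero⁺ : ∀ {x} → ¬ x ≈ 0# → x ∈ nonzero
  ∈-nonzero⁺ {x} = ∈-filter⁺ setoid ≉0? ≉0-resp-≈ (complete x)

  ∈-nonzero⁻ : ∀ {x} → x ∈ nonzero → ¬ x ≈ 0#
  ∈-nonzero⁻ x∈ = proj₂ (∈-filter⁻ setoid ≉0? ≉0-resp-≈ {xs = elements} x∈)

  nonzero-unique : Unique nonzero
  nonzero-unique = UniqueProps.filter⁺ setoid ≉0? {xs = elements} distinct

  length-elements : length elements ≡ suc (length nonzero)
  length-elements = ℕ.≤-antisym
    (Unique-⊆⇒length≤ setoid distinct elements⊆0∷nonzero)
    (Unique-⊆⇒length≤ setoid 0∷nonzero-unique (λ {x} _ → complete x))
    where
    elements⊆0∷nonzero : ∀ {x} → x ∈ elements → x ∈ 0# ∷ nonzero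
    elements⊆0∷nonzero {x} _ with x ≟ 0#
    ... | yes x≈0 = here x≈0
    ... | no x≉0 = there (∈-nonzero⁺ x≉0)
    0∷nonzero-unique : Unique (0# ∷ nonzero)
    0∷nonzero-unique = All.tabulateₛ setoid (λ x∈ 0≈x → ∈-nonzero⁻ x∈ (sym 0≈x)) ∷ nonzero-unique

  ∏ : List Carrier → Carrier
  ∏ = foldr _*_ 1#

  ∏-map-* : ∀ x xs → ∏ (map (x *_) xs) ≈ x ^ length xs * ∏ xs
  ∏-map-* x [] = sym (*-identityˡ 1#)
  ∏-map-* x (y ∷ ys) = begin
    x * y * ∏ (map (x *_) ys)        ≈⟨ *-congˡ (∏-map-* x ys) ⟩
    x * y * (x ^ length ys * ∏ ys)   ≈⟨ interchange x y _ _ ⟩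
    x * x ^ length ys * (y * ∏ ys)   ∎
    where open CommutativeSemigroupProperties *-commutativeSemigroup using (interchange)

  ∏-nonzero≉0 : ∀ {xs} → (∀ {x} → x ∈ xs → ¬ x ≈ 0#) → ¬ ∏ xs ≈ 0#
  ∏-nonzero≉0 {[]} _ = 1≉0
  ∏-nonzero≉0 {x ∷ xs} xs≉0 x∏≈0 = ∏-nonzero≉0 (λ x∈ → xs≉0 (there x∈))
    (x*y≈0⇒y≈0 (xs≉0 (here refl)) x∏≈0)

  x^[q-1]≈1 : ∀ {x} → ¬ x ≈ 0# → x ^ length nonzero ≈ 1#
  x^[q-1]≈1 {x} x≉0 = *-cancelˡ-≉0 (∏-nonzero≉0 ∈-nonzero⁻) (begin
    ∏ nonzero * x ^ length nonzero   ≈⟨ *-comm _ _ ⟩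
    x ^ length nonzero * ∏ nonzero   ≈⟨ ∏-map-* x nonzero ⟨
    ∏ (map (x *_) nonzero)           ≈⟨ PermutationProps.foldr-commMonoid setoid *-isCommutativeMonoid nonzero↭x*nonzero ⟨
    ∏ nonzero                        ≈⟨ *-identityʳ _ ⟨
    ∏ nonzero * 1#                   ∎)
    where
    nonzero↭x*nonzero : nonzero ↭ map (x *_) nonzero
    nonzero↭x*nonzero = Unique-⊆-length≡⇒↭ setoid
      (UniqueProps.map⁺ setoid setoid (*-cancelˡ-≉0 x≉0) nonzero-unique) (length-map (x *_) nonzero)
      λ y∈ → let a , a∈ , y≈xa = ∈-map⁻ setoid setoid y∈ in
        ∈-nonzero⁺ λ y≈0 → ∈-nonzero⁻ a∈ (x*y≈0⇒y≈0 x≉0 (trans (sym y≈xa) y≈0))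

  x^q≈x : ∀ x → x ^ (2 ℕ.^ h) ≈ x
  x^q≈x x = trans (^-congʳ x (≡.trans (≡.sym size) length-elements)) (x*x^[q-1]≈x x)
    where
    x*x^[q-1]≈x : ∀ x → x * x ^ length nonzero ≈ x
    x*x^[q-1]≈x x with x ≟ 0#
    ... | yes x≈0 = trans (*-congʳ x≈0) (trans (zeroˡ _) (sym x≈0))
    ... | no x≉0  = trans (*-congˡ (x^[q-1]≈1 x≉0)) (*-identityʳ x)

module Trace {h : ℕ} (F : FiniteField2 h) where
  open FiniteField2 F
  open FiniteField2Properties F
  open Characteristic2 cring char2
  open SetoidReasoning setoid
  open Exp semiring using (_^_; ^-homo-*; ^-congʳ)
  open GroupProperties +-group using (∙-cancelˡ)

  Tr-aux-cong : ∀ i {x y} → x ≈ y → Tr-aux F i x ≈ Tr-aux F i y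
  Tr-aux-cong zero    x≈y = refl
  Tr-aux-cong (suc i) x≈y = +-cong x≈y (Tr-aux-cong i (*-cong x≈y x≈y))

  Tr-aux-homo-+ : ∀ i x y → Tr-aux F i (x + y) ≈ Tr-aux F i x + Tr-aux F i y
  Tr-aux-homo-+ zero    x y = sym (+-identityʳ 0#)
  Tr-aux-homo-+ (suc i) x y = begin
    x + y + Tr-aux F i ((x + y) * (x + y))              ≈⟨ +-congˡ (Tr-aux-cong i ([x+y]²≈x²+y² x y)) ⟩
    x + y + Tr-aux F i (x * x + y * y)                  ≈⟨ +-congˡ (Tr-aux-homo-+ i (x * x) (y * y)) ⟩
    x + y + (Tr-aux F i (x * x) + Tr-aux F i (y * y))   ≈⟨ interchange x y _ _ ⟩
    x + Tr-aux F i (x * x) + (y + Tr-aux F i (y * y))   ∎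
    where open CommutativeSemigroupProperties +-commutativeSemigroup using (interchange)

  Tr-aux-0 : ∀ i → Tr-aux F i 0# ≈ 0#
  Tr-aux-0 zero    = refl
  Tr-aux-0 (suc i) = trans (+-identityˡ _) (trans (Tr-aux-cong i (zeroˡ 0#)) (Tr-aux-0 i))

  Tr-aux-suc : ∀ i y → Tr-aux F (suc i) y ≈ Tr-aux F i y + y ^ (2 ℕ.^ i)
  Tr-aux-suc zero    y = trans (+-identityʳ y) (sym (trans (+-identityˡ _) (*-identityʳ y)))
  Tr-aux-suc (suc i) y = begin
    y + Tr-aux F (suc i) (y * y)                ≈⟨ +-congˡ (Tr-aux-suc i (y * y)) ⟩
    y + (Tr-aux F i (y * y) + (y * y) ^ 2ⁱ)      ≈⟨ +-assoc _ _ _ ⟨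
    Tr-aux F (suc i) y + (y * y) ^ 2ⁱ           ≈⟨ +-congˡ (^-distrib-* y y 2ⁱ) ⟩
    Tr-aux F (suc i) y + y ^ 2ⁱ * y ^ 2ⁱ        ≈⟨ +-congˡ (^-homo-* y 2ⁱ 2ⁱ) ⟨
    Tr-aux F (suc i) y + y ^ (2ⁱ ℕ.+ 2ⁱ)        ≈⟨ +-congˡ (^-congʳ y (≡.cong (2ⁱ ℕ.+_) (ℕ.+-identityʳ 2ⁱ))) ⟨
    Tr-aux F (suc i) y + y ^ (2 ℕ.^ suc i)      ∎
    where
    2ⁱ : ℕ
    2ⁱ = 2 ℕ.^ i
    open CommutativeSemiringExp commutativeSemiring using (^-distrib-*)

  Tr-aux-square : ∀ i y → Tr-aux F i y * Tr-aux F i y ≈ Tr-aux F i (y * y)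
  Tr-aux-square zero    y = zeroʳ 0#
  Tr-aux-square (suc i) y = trans ([x+y]²≈x²+y² y _) (+-congˡ (Tr-aux-square i (y * y)))

  Tr-aux-1-step : ∀ i → Tr-aux F (suc (suc i)) 1# ≈ Tr-aux F i 1#
  Tr-aux-1-step i = begin
    1# + (1# * 1# + Tr-aux F i (1# * 1# * (1# * 1#)))  ≈⟨ +-congˡ (+-cong 1*1≈1 (Tr-aux-cong i 1*1*[1*1]≈1)) ⟩
    1# + (1# + Tr-aux F i 1#)                          ≈⟨ x+[x+y]≈y 1# _ ⟩
    Tr-aux F i 1#                                      ∎
    where
    1*1≈1 : 1# * 1# ≈ 1#
    1*1≈1 = *-identityˡ 1#
    1*1*[1*1]≈1 : 1# * 1# * (1# * 1#) ≈ 1#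
    1*1*[1*1]≈1 = trans (*-cong 1*1≈1 1*1≈1) 1*1≈1

  Tr-aux-odd-1 : ∀ k → Tr-aux F (suc (2 ℕ.* k)) 1# ≈ 1#
  Tr-aux-odd-1 zero    = +-identityʳ 1#
  Tr-aux-odd-1 (suc k) = ≡.subst (λ n → Tr-aux F (suc n) 1# ≈ 1#) (≡.sym (ℕ.*-suc 2 k))
    (trans (Tr-aux-1-step (suc (2 ℕ.* k))) (Tr-aux-odd-1 k))

  Tr-cong : ∀ {x y} → x ≈ y → Tr F x ≈ Tr F y
  Tr-cong = Tr-aux-cong h

  Tr-homo-+ : ∀ x y → Tr F (x + y) ≈ Tr F x + Tr F y
  Tr-homo-+ = Tr-aux-homo-+ h

  Tr[x²]≈Tr[x] : ∀ x → Tr F (x * x) ≈ Tr F x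
  Tr[x²]≈Tr[x] x = ∙-cancelˡ x _ _ (begin
    x + Tr F (x * x)           ≈⟨ Tr-aux-suc h x ⟩
    Tr F x + x ^ (2 ℕ.^ h)     ≈⟨ +-congˡ (x^q≈x x) ⟩
    Tr F x + x                 ≈⟨ +-comm _ x ⟩
    x + Tr F x                 ∎)

  Tr≈0⊎Tr≈1 : ∀ x → Tr F x ≈ 0# ⊎ Tr F x ≈ 1#
  Tr≈0⊎Tr≈1 x with Tr F x ≟ 0#
  ... | yes t≈0 = inj₁ t≈0
  ... | no t≉0 = inj₂ (x+y≈0⇒x≈y (x*y≈0⇒y≈0 t≉0 (begin
    t * (t + 1#)    ≈⟨ distribˡ t t 1# ⟩
    t * t + t * 1#  ≈⟨ +-cong (trans (Tr-aux-square h x) (Tr[x²]≈Tr[x] x)) (*-identityʳ t) ⟩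
    t + t           ≈⟨ x+x≈0 t ⟩
    0#              ∎)))
    where
    t : Carrier
    t = Tr F x

  infix 4 _⟂_ _⟂?_
  _⟂_ : Carrier → Carrier → Set
  x ⟂ y = Tr F (x * y) ≈ 0#

  _⟂?_ : Decidable _⟂_
  x ⟂? y = Tr F (x * y) ≟ 0#

  ⟂-sym : ∀ {x y} → x ⟂ y → y ⟂ x
  ⟂-sym {x} {y} = trans (Tr-cong (*-comm y x))

  ⟂-respˡ : ∀ {x x′ y} → x ≈ x′ → x ⟂ y → x′ ⟂ y
  ⟂-respˡ x≈x′ = trans (Tr-cong (*-congʳ (sym x≈x′)))

  ⟂-respʳ : ∀ {x y y′} → y ≈ y′ → x ⟂ y → x ⟂ y′
  ⟂-respʳ y≈y′ = trans (Tr-cong (*-congˡ (sym y≈y′)))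

  ⟂-+ʳ : ∀ {x y z} → x ⟂ y → x ⟂ z → x ⟂ y + z
  ⟂-+ʳ {x} {y} {z} x⟂y x⟂z = begin
    Tr F (x * (y + z))               ≈⟨ Tr-cong (distribˡ x y z) ⟩
    Tr F (x * y + x * z)             ≈⟨ Tr-homo-+ _ _ ⟩
    Tr F (x * y) + Tr F (x * z)      ≈⟨ +-cong x⟂y x⟂z ⟩
    0# + 0#                          ≈⟨ +-identityʳ 0# ⟩
    0#                               ∎

  ⟂-+ˡ : ∀ {x y z} → x ⟂ z → y ⟂ z → x + y ⟂ z
  ⟂-+ˡ x⟂z y⟂z = ⟂-sym (⟂-+ʳ (⟂-sym x⟂z) (⟂-sym y⟂z))

  ¬⟂-+ʳ : ∀ {x y z} → ¬ x ⟂ y → ¬ x ⟂ z → x ⟂ y + z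
  ¬⟂-+ʳ {x} {y} {z} x⟂̸y x⟂̸z = begin
    Tr F (x * (y + z))               ≈⟨ Tr-cong (distribˡ x y z) ⟩
    Tr F (x * y + x * z)             ≈⟨ Tr-homo-+ _ _ ⟩
    Tr F (x * y) + Tr F (x * z)      ≈⟨ +-cong (≉0⇒≈1 x⟂̸y) (≉0⇒≈1 x⟂̸z) ⟩
    1# + 1#                          ≈⟨ char2 ⟩
    0#                               ∎
    where
    ≉0⇒≈1 : ∀ {t} → ¬ Tr F t ≈ 0# → Tr F t ≈ 1#
    ≉0⇒≈1 {t} t≉0 with Tr≈0⊎Tr≈1 t
    ... | inj₁ t≈0 = contradiction t≈0 t≉0
    ... | inj₂ t≈1 = t≈1

  ≈0⇒⟂ : ∀ {x} y → x ≈ 0# → x ⟂ y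
  ≈0⇒⟂ {x} y x≈0 = trans (Tr-cong (trans (*-congʳ x≈0) (zeroˡ y))) (Tr-aux-0 h)

  1⟂x⇒x⟂x : ∀ {x} → 1# ⟂ x → x ⟂ x
  1⟂x⇒x⟂x {x} 1⟂x = trans (Tr[x²]≈Tr[x] x) (trans (Tr-cong (sym (*-identityˡ x))) 1⟂x)

module Orthogonals {h : ℕ} (F : FiniteField2 h) where
  open FiniteField2 F
  open Trace F
  open Characteristic2 cring char2 using (x+[x+y]≈y)
  open Membership setoid using (_∈_; find; lose)
  open MembershipProps using (∈-filter⁺; ∈-filter⁻; ∈-++⁺ˡ; ∈-++⁺ʳ; ∈-map⁺; ∈-resp-≈)
  open Subset setoid using (_⊆_)
  open UniqueSetoid setoid using (Unique)

  OrthogonalTo : List Carrier → Carrier → Set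
  OrthogonalTo cs x = All (_⟂ x) cs

  orthogonalTo? : ∀ cs → Relation.Unary.Decidable (OrthogonalTo cs)
  orthogonalTo? cs x = all? (_⟂? x) cs

  orthogonalTo-resp-≈ : ∀ cs {x y} → x ≈ y → OrthogonalTo cs x → OrthogonalTo cs y
  orthogonalTo-resp-≈ cs x≈y = All.map (⟂-respʳ x≈y)

  orthogonalTo-+ : ∀ {cs x y} → OrthogonalTo cs x → OrthogonalTo cs y → OrthogonalTo cs (x + y)
  orthogonalTo-+ []              []              = []
  orthogonalTo-+ (u⟂x ∷ cs⟂x) (u⟂y ∷ cs⟂y) = ⟂-+ʳ u⟂x u⟂y ∷ orthogonalTo-+ cs⟂x cs⟂y

  orthogonals : List Carrier → List Carrier
  orthogonals cs = filter (orthogonalTo? cs) elements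

  ∈-orthogonals⁺ : ∀ cs {x} → OrthogonalTo cs x → x ∈ orthogonals cs
  ∈-orthogonals⁺ cs {x} = ∈-filter⁺ setoid (orthogonalTo? cs) (orthogonalTo-resp-≈ cs) (complete x)

  ∈-orthogonals⁻ : ∀ cs {x} → x ∈ orthogonals cs → OrthogonalTo cs x
  ∈-orthogonals⁻ cs x∈ =
    proj₂ (∈-filter⁻ setoid (orthogonalTo? cs) (orthogonalTo-resp-≈ cs) {xs = elements} x∈)

  orthogonals-unique : ∀ cs → Unique (orthogonals cs)
  orthogonals-unique cs = UniqueProps.filter⁺ setoid (orthogonalTo? cs) {xs = elements} distinct

  -- Any s ∈ orthogonals cs with ¬ u ⟂ s works, as Tr takes only the values 0 and 1;
  -- if there is none, the condition is vacuous.
  ∃-translation : ∀ u cs → ∃ λ s →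
    ∀ {x} → x ∈ orthogonals cs → ¬ u ⟂ x → s + x ∈ orthogonals (u ∷ cs)
  ∃-translation u cs with any? (λ x → ¬? (u ⟂? x)) (orthogonals cs)
  ... | yes some = let s , s∈ , u⟂̸s = find some in s , λ x∈ u⟂̸x →
    ∈-orthogonals⁺ (u ∷ cs) (¬⟂-+ʳ u⟂̸s u⟂̸x ∷ orthogonalTo-+ (∈-orthogonals⁻ cs s∈) (∈-orthogonals⁻ cs x∈))
  ... | no none = 0# , λ x∈ u⟂̸x → contradiction (lose ¬⟂-resp x∈ u⟂̸x) none
    where
    ¬⟂-resp : ∀ {x y} → x ≈ y → ¬ u ⟂ x → ¬ u ⟂ y
    ¬⟂-resp x≈y u⟂̸x u⟂y = u⟂̸x (⟂-respʳ (sym x≈y) u⟂y)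

  length-orthogonals-∷ : ∀ u cs → length (orthogonals cs) ≤ 2 ℕ.* length (orthogonals (u ∷ cs))
  length-orthogonals-∷ u cs = ℕ.≤-trans (Unique-⊆⇒length≤ setoid (orthogonals-unique cs) O⊆O′∪s+O′)
    (ℕ.≤-reflexive (≡.trans (length-++ O′) (≡.cong (length O′ ℕ.+_)
      (≡.trans (length-map (s +_) O′) (≡.sym (ℕ.+-identityʳ _))))))
    where
    O′ : List Carrier
    O′ = orthogonals (u ∷ cs)
    s : Carrier
    s = proj₁ (∃-translation u cs)
    s+x∈O′ : ∀ {x} → x ∈ orthogonals cs → ¬ u ⟂ x → s + x ∈ O′
    s+x∈O′ = proj₂ (∃-translation u cs)
    O⊆O′∪s+O′ : orthogonals cs ⊆ O′ ++ map (s +_) O′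
    O⊆O′∪s+O′ {x} x∈ with u ⟂? x
    ... | yes u⟂x = ∈-++⁺ˡ setoid (∈-orthogonals⁺ (u ∷ cs) (u⟂x ∷ ∈-orthogonals⁻ cs x∈))
    ... | no u⟂̸x = ∈-++⁺ʳ setoid O′ (∈-resp-≈ setoid (x+[x+y]≈y s x)
      (∈-map⁺ setoid setoid +-congˡ (s+x∈O′ x∈ u⟂̸x)))

  length-orthogonals : ∀ cs → 2 ℕ.^ h ≤ length (orthogonals cs) ℕ.* 2 ℕ.^ length cs
  length-orthogonals [] = ℕ.≤-reflexive (begin-equality
    2 ℕ.^ h                              ≡⟨ size ⟨
    length elements                      ≡⟨ ≡.cong length (filter-all (orthogonalTo? []) (All.universal (λ _ → []) elements)) ⟨
    length (orthogonals [])              ≡⟨ ℕ.*-identityʳ _ ⟨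
    length (orthogonals []) ℕ.* 1        ∎)
    where open ℕ.≤-Reasoning
  length-orthogonals (u ∷ cs) = begin
    2 ℕ.^ h                             ≤⟨ length-orthogonals cs ⟩
    length (orthogonals cs) ℕ.* 2ⁿ      ≤⟨ ℕ.*-monoˡ-≤ 2ⁿ (length-orthogonals-∷ u cs) ⟩
    2 ℕ.* m ℕ.* 2ⁿ                      ≡⟨ ≡.cong (ℕ._* 2ⁿ) (ℕ.*-comm 2 m) ⟩
    m ℕ.* 2 ℕ.* 2ⁿ                      ≡⟨ ℕ.*-assoc m 2 2ⁿ ⟩
    m ℕ.* 2 ℕ.^ length (u ∷ cs)         ∎
    where
    open ℕ.≤-Reasoning
    m 2ⁿ : ℕ
    m = length (orthogonals (u ∷ cs))
    2ⁿ = 2 ℕ.^ length cs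

  many-orthogonals : ∀ cs {j} → j ℕ.+ length cs < h → 2 ℕ.^ j < length (orthogonals cs)
  many-orthogonals cs {j} j+n<h = ℕ.≰⇒> λ |O|≤2ʲ → ℕ.<⇒≱ (ℕ.^-monoʳ-< 2 (ℕ.n<1+n 1) j+n<h) (begin
    2 ℕ.^ h                                         ≤⟨ length-orthogonals cs ⟩
    length (orthogonals cs) ℕ.* 2 ℕ.^ length cs     ≤⟨ ℕ.*-monoˡ-≤ _ |O|≤2ʲ ⟩
    2 ℕ.^ j ℕ.* 2 ℕ.^ length cs                     ≡⟨ ℕ.^-distribˡ-+-* 2 j (length cs) ⟨
    2 ℕ.^ (j ℕ.+ length cs)                         ∎)
    where open ℕ.≤-Reasoning

module IsotropicSubgroups {h : ℕ} (F : FiniteField2 h) where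
  open FiniteField2 F
  open FiniteField2Properties F using (_≟_)
  open Trace F
  open Orthogonals F
  open Characteristic2 cring char2
  open Membership setoid using (_∈_; _∉_)
  open MembershipProps using (∈-++⁺ˡ; ∈-++⁺ʳ; ∈-++⁻; ∈-map⁺; ∈-map⁻; ∈-resp-≈)
  open CommutativeSemigroupProperties +-commutativeSemigroup using (x∙yz≈y∙xz)

  ∈-++-translate⁻ : ∀ v A {x} → x ∈ A ++ map (v +_) A → x ∈ A ⊎ ∃ λ a → a ∈ A × x ≈ v + a
  ∈-++-translate⁻ v A x∈ with ∈-++⁻ setoid A x∈
  ... | inj₁ x∈A   = inj₁ x∈A
  ... | inj₂ x∈v+A = inj₂ (∈-map⁻ setoid setoid x∈v+A)

  ∈-++-translate⁺ : ∀ v A {a x} → a ∈ A → x ≈ v + a → x ∈ A ++ map (v +_) A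
  ∈-++-translate⁺ v A a∈A x≈v+a =
    ∈-++⁺ʳ setoid A (∈-resp-≈ setoid (sym x≈v+a) (∈-map⁺ setoid setoid +-congˡ a∈A))

  ++-translate-isSubgroup : ∀ {A n v} → IsAdditiveSubgroupOfOrder F A n → v ∉ A →
                            IsAdditiveSubgroupOfOrder F (A ++ map (v +_) A) (2 ℕ.* n)
  ++-translate-isSubgroup {A} {n} {v} (!A , |A|≡n , 0∈A , +-closed , _) v∉A =
    UniqueProps.++⁺ setoid !A (UniqueProps.map⁺ setoid setoid (∙-cancelˡ v _ _) !A) disjoint ,
    ≡.trans (length-++ A) (≡.cong₂ ℕ._+_ |A|≡n
      (≡.trans (length-map (v +_) A) (≡.trans |A|≡n (≡.sym (ℕ.+-identityʳ n))))) ,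
    ∈-++⁺ˡ setoid 0∈A ,
    +-closed′ ,
    λ x x∈ → ∈-resp-≈ setoid (sym (-x≈x x)) x∈
    where
    open GroupProperties +-group using (∙-cancelˡ)
    disjoint : ∀ {x} → ¬ (x ∈ A × x ∈ map (v +_) A)
    disjoint {x} (x∈A , x∈v+A) with a , a∈A , x≈v+a ← ∈-map⁻ setoid setoid x∈v+A =
      v∉A (∈-resp-≈ setoid a+x≈v (+-closed a x a∈A x∈A))
      where
      a+x≈v : a + x ≈ v
      a+x≈v = trans (+-congˡ (trans x≈v+a (+-comm v a))) (x+[x+y]≈y a v)
    +-closed′ : ∀ x y → x ∈ A ++ map (v +_) A → y ∈ A ++ map (v +_) A → x + y ∈ A ++ map (v +_) A
    +-closed′ x y x∈ y∈ with ∈-++-translate⁻ v A x∈ | ∈-++-translate⁻ v A y∈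
    ... | inj₁ x∈A | inj₁ y∈A = ∈-++⁺ˡ setoid (+-closed x y x∈A y∈A)
    ... | inj₁ x∈A | inj₂ (b , b∈A , y≈v+b) =
      ∈-++-translate⁺ v A (+-closed x b x∈A b∈A) (trans (+-congˡ y≈v+b) (x∙yz≈y∙xz x v b))
    ... | inj₂ (a , a∈A , x≈v+a) | inj₁ y∈A =
      ∈-++-translate⁺ v A (+-closed a y a∈A y∈A) (trans (+-congʳ x≈v+a) (+-assoc v a y))
    ... | inj₂ (a , a∈A , x≈v+a) | inj₂ (b , b∈A , y≈v+b) =
      ∈-resp-≈ setoid (sym (trans (+-cong x≈v+a y≈v+b) ([x+y]+[x+z]≈y+z v a b)))
        (∈-++⁺ˡ setoid (+-closed a b a∈A b∈A))

  ⟂-++-translate : ∀ {A v w} → (∀ {a} → a ∈ A → a ⟂ w) → v ⟂ w →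
                   ∀ {x} → x ∈ A ++ map (v +_) A → x ⟂ w
  ⟂-++-translate {A} {v} A⟂w v⟂w x∈ with ∈-++-translate⁻ v A x∈
  ... | inj₁ x∈A               = A⟂w x∈A
  ... | inj₂ (a , a∈A , x≈v+a) = ⟂-respˡ (sym x≈v+a) (⟂-+ˡ v⟂w (A⟂w a∈A))

  -- basis spans members; it is carried so that the extension step imposes j + 1 trace
  -- conditions instead of 2^j + 1.
  record IsotropicSubgroup (j : ℕ) : Set where
    field
      members          : List Carrier
      isSubgroup       : IsAdditiveSubgroupOfOrder F members (2 ℕ.^ j)
      isotropic        : ∀ {x y} → x ∈ members → y ∈ members → x ⟂ y
      basis            : List Carrier
      length-basis     : length basis ≡ j
      ⟂basis⇒⟂members : ∀ {w} → OrthogonalTo basis w → ∀ {x} → x ∈ members → x ⟂ w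

  zeroSubgroup : IsotropicSubgroup 0
  zeroSubgroup = record
    { members          = 0# ∷ []
    ; isSubgroup       = [] ∷ [] , ≡.refl , here refl , +-closed , λ x x∈ → here (trans (-x≈x x) (≈0 x∈))
    ; isotropic        = λ x∈ _ → ≈0⇒⟂ _ (≈0 x∈)
    ; basis            = []
    ; length-basis     = ≡.refl
    ; ⟂basis⇒⟂members = λ _ x∈ → ≈0⇒⟂ _ (≈0 x∈)
    }
    where
    ≈0 : ∀ {x} → x ∈ 0# ∷ [] → x ≈ 0#
    ≈0 (here x≈0) = x≈0
    +-closed : ∀ x y → x ∈ 0# ∷ [] → y ∈ 0# ∷ [] → x + y ∈ 0# ∷ []
    +-closed x y x∈ y∈ = here (trans (+-cong (≈0 x∈) (≈0 y∈)) (+-identityʳ 0#))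

  extend : ∀ {j} → j ℕ.+ suc j < h → IsotropicSubgroup j → IsotropicSubgroup (suc j)
  extend {j} j+[1+j]<h W = record
    { members          = members ++ map (v +_) members
    ; isSubgroup       = ++-translate-isSubgroup isSubgroup v∉members
    ; isotropic        = λ x∈ y∈ → ⟂-++-translate
        (λ a∈ → ⟂-sym (⟂-++-translate (λ a′∈ → isotropic a′∈ a∈) (⟂-sym (members⟂v a∈)) y∈))
        (⟂-sym (⟂-++-translate members⟂v v⟂v y∈)) x∈
    ; basis            = v ∷ basis
    ; length-basis     = ≡.cong suc length-basis
    ; ⟂basis⇒⟂members = λ v∷basis⟂w → ⟂-++-translate (⟂basis⇒⟂members (All.tail v∷basis⟂w)) (All.head v∷basis⟂w)
    }
    where
    open IsotropicSubgroup W
    candidate : ∃ λ v → v ∈ orthogonals (1# ∷ basis) × v ∉ members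
    candidate = longer⇒∃∉ setoid _≟_ (orthogonals-unique (1# ∷ basis))
      (≡.subst (_< length (orthogonals (1# ∷ basis))) (≡.sym (proj₁ (proj₂ isSubgroup)))
        (many-orthogonals (1# ∷ basis) (≡.subst (λ n → j ℕ.+ suc n < h) (≡.sym length-basis) j+[1+j]<h)))
    v : Carrier
    v = proj₁ candidate
    v∉members : v ∉ members
    v∉members = proj₂ (proj₂ candidate)
    [1∷basis]⟂v : OrthogonalTo (1# ∷ basis) v
    [1∷basis]⟂v = ∈-orthogonals⁻ (1# ∷ basis) (proj₁ (proj₂ candidate))
    members⟂v : ∀ {a} → a ∈ members → a ⟂ v
    members⟂v = ⟂basis⇒⟂members (All.tail [1∷basis]⟂v)
    v⟂v : v ⟂ v
    v⟂v = 1⟂x⇒x⟂x (All.head [1∷basis]⟂v)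

  isotropicSubgroup : ∀ j → j ℕ.+ j ≤ h → IsotropicSubgroup j
  isotropicSubgroup zero    _          = zeroSubgroup
  isotropicSubgroup (suc j) 2[1+j]≤h = extend 2[1+j]≤h
    (isotropicSubgroup j (ℕ.≤-trans (ℕ.+-monoʳ-≤ j (ℕ.n≤1+n j)) (ℕ.<⇒≤ 2[1+j]≤h)))

module DennistonConics {h : ℕ} (F : FiniteField2 h) where
  open FiniteField2 F
  open FiniteField2Properties F
  open Trace F
  open NormForm cring
  open Characteristic2 cring char2
  open SetoidReasoning setoid
  open NaturalSolver commutativeSemiring using (solve; _:=_; _:*_)

  Tr[norm[t,1]]≈Tr[α] : ∀ α t → Tr F (norm α t 1#) ≈ Tr F α
  Tr[norm[t,1]]≈Tr[α] α t = begin
    Tr F (t * t + t * 1# + α * (1# * 1#))              ≈⟨ Tr-homo-+ _ _ ⟩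
    Tr F (t * t + t * 1#) + Tr F (α * (1# * 1#))       ≈⟨ +-cong (Tr-homo-+ _ _) (Tr-cong (trans (*-congˡ (*-identityˡ 1#)) (*-identityʳ α))) ⟩
    Tr F (t * t) + Tr F (t * 1#) + Tr F α              ≈⟨ +-congʳ (+-cong (Tr[x²]≈Tr[x] t) (Tr-cong (*-identityʳ t))) ⟩
    Tr F t + Tr F t + Tr F α                           ≈⟨ +-congʳ (x+x≈0 _) ⟩
    0# + Tr F α                                        ≈⟨ +-identityˡ _ ⟩
    Tr F α                                             ∎

  Tr[norm/s²]≈Tr[α] : ∀ α e {s r} → s * r ≈ 1# → Tr F (norm α e s * (r * r)) ≈ Tr F α
  Tr[norm/s²]≈Tr[α] α e {s} {r} sr≈1 = begin
    Tr F (norm α e s * (r * r))      ≈⟨ Tr-cong (norm-scale α e s r) ⟩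
    Tr F (norm α (e * r) (s * r))    ≈⟨ Tr-cong (norm-cong α refl sr≈1) ⟩
    Tr F (norm α (e * r) 1#)         ≈⟨ Tr[norm[t,1]]≈Tr[α] α (e * r) ⟩
    Tr F α                                 ∎

  module _ {α} (Trα≈1 : Tr F α ≈ 1#) where

    norm≈0⇒≈0 : ∀ {a b} → norm α a b ≈ 0# → a ≈ 0# × b ≈ 0#
    norm≈0⇒≈0 {a} {b} N≈0 with b ≟ 0#
    ... | yes b≈0 = x*x≈0⇒x≈0 (begin
      a * a                          ≈⟨ +-identityʳ _ ⟨
      a * a + 0#                     ≈⟨ +-congˡ (trans (*-congˡ b≈0) (zeroʳ a)) ⟨
      a * a + a * b                  ≈⟨ +-identityʳ _ ⟨
      a * a + a * b + 0#             ≈⟨ +-congˡ (trans (*-congˡ (trans (*-congʳ b≈0) (zeroˡ b))) (zeroʳ α)) ⟨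
      norm α a b               ≈⟨ N≈0 ⟩
      0#                             ∎) , b≈0
    ... | no b≉0 with r , br≈1 ← inverse b b≉0 = contradiction (begin
      1#                             ≈⟨ Trα≈1 ⟨
      Tr F α                         ≈⟨ Tr[norm/s²]≈Tr[α] α a br≈1 ⟨
      Tr F (norm α a b * (r * r)) ≈⟨ Tr-cong (trans (*-congʳ N≈0) (zeroˡ _)) ⟩
      Tr F 0#                        ≈⟨ Tr-aux-0 h ⟩
      0#                             ∎) 1≉0

    conic-x₁≉0 : ∀ {x₁ x₂ x₃ μ} → NonZeroTriple F (x₁ , x₂ , x₃) → OnConic F α μ (x₁ , x₂ , x₃) → ¬ x₁ ≈ 0#
    conic-x₁≉0 {x₁} {x₂} {x₃} {μ} P≢0 P∈C x₁≈0 = P≢0 (x₁≈0 , norm≈0⇒≈0 (begin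
      norm α x₂ x₃      ≈⟨ x+y≈0⇒x≈y P∈C ⟩
      μ * (x₁ * x₁)          ≈⟨ *-congˡ (trans (*-congʳ x₁≈0) (zeroˡ x₁)) ⟩
      μ * 0#                 ≈⟨ zeroʳ μ ⟩
      0#                     ∎))

    perp-conics⇒Tr[μν]≈1 : ∀ P Q {μ ν} → NonZeroTriple F P → NonZeroTriple F Q →
      OnConic F α μ P → OnConic F α ν Q → OnPerp F P Q → Tr F (μ * ν) ≈ 1#
    perp-conics⇒Tr[μν]≈1 (x₁ , a , b) (y₁ , c , d) {μ} {ν} P≢0 Q≢0 P∈Cμ Q∈Cν P⟂Q
      with r , sr≈1 ← inverse (x₁ * y₁) (x*y≉0 (conic-x₁≉0 P≢0 P∈Cμ) (conic-x₁≉0 Q≢0 Q∈Cν)) = begin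
      Tr F (μ * ν)                                                     ≈⟨ Tr-cong μν≈N/s² ⟩
      Tr F (norm α (a * c + a * d + α * (b * d)) s * (r * r))   ≈⟨ Tr[norm/s²]≈Tr[α] α _ sr≈1 ⟩
      Tr F α                                                           ≈⟨ Trα≈1 ⟩
      1#                                                               ∎
      where
      s : Carrier
      s = x₁ * y₁
      s≈ad+bc : s ≈ a * d + b * c
      s≈ad+bc = trans (x+y≈0⇒x≈y (trans (sym (+-assoc s (b * c) (a * d))) P⟂Q)) (+-comm (b * c) (a * d))
      μν≈N/s² : μ * ν ≈ norm α (a * c + a * d + α * (b * d)) s * (r * r)
      μν≈N/s² = begin
        μ * ν                                                   ≈⟨ *-identityʳ _ ⟨
        μ * ν * 1#                                              ≈⟨ *-congˡ (trans (sym (*-identityʳ 1#)) (sym (*-cong sr≈1 sr≈1))) ⟩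
        μ * ν * ((s * r) * (s * r))                             ≈⟨ regroup ⟩
        μ * (x₁ * x₁) * (ν * (y₁ * y₁)) * (r * r)               ≈⟨ *-congʳ (*-cong (sym (x+y≈0⇒x≈y P∈Cμ)) (sym (x+y≈0⇒x≈y Q∈Cν))) ⟩
        norm α a b * norm α c d * (r * r)           ≈⟨ *-congʳ (norm-product α a b c d) ⟩
        norm α (a * c + a * d + α * (b * d)) (a * d + b * c) * (r * r) ≈⟨ *-congʳ (norm-cong α refl (sym s≈ad+bc)) ⟩
        norm α (a * c + a * d + α * (b * d)) s * (r * r)  ∎
        where
        regroup : μ * ν * ((s * r) * (s * r)) ≈ μ * (x₁ * x₁) * (ν * (y₁ * y₁)) * (r * r)
        regroup = solve 5 (λ μ ν x y r → μ :* ν :* ((x :* y :* r) :* (x :* y :* r))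
                                         := μ :* (x :* x) :* (ν :* (y :* y)) :* (r :* r)) refl μ ν x₁ y₁ r

open import Data.Nat using (_*_; _^_)

theorem2p14 : (k : ℕ) (F : FiniteField2 (suc (2 * k))) →
    Σ (FiniteField2.Carrier F) λ α →
      FiniteField2._≈_ F (Tr F α) (FiniteField2.1# F) ×
      Σ (List (FiniteField2.Carrier F)) λ A →
        IsAdditiveSubgroupOfOrder F A (2 ^ k) ×
        (∀ P Q → NonZeroTriple F P → NonZeroTriple F Q →
          InDenniston F α A P → OnPerp F P Q → ¬ InDenniston F α A Q)
theorem2p14 k F = 1# , Tr[1]≈1 , members , isSubgroup ,
  λ P Q P≢0 Q≢0 (μ , μ∈A , P∈Cμ) P⟂Q (ν , ν∈A , Q∈Cν) →
    1≉0 (trans (sym (perp-conics⇒Tr[μν]≈1 Tr[1]≈1 P Q P≢0 Q≢0 P∈Cμ Q∈Cν P⟂Q)) (isotropic μ∈A ν∈A))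
  where
  open FiniteField2 F using (_≈_; 1#; 1≉0; trans; sym)
  open Trace F using (Tr-aux-odd-1)
  open DennistonConics F using (perp-conics⇒Tr[μν]≈1)
  open IsotropicSubgroups F using (module IsotropicSubgroup; isotropicSubgroup)
  Tr[1]≈1 : Tr F 1# ≈ 1#
  Tr[1]≈1 = Tr-aux-odd-1 k
  k+k≤h : k ℕ.+ k ≤ suc (2 * k)
  k+k≤h = ℕ.≤-trans (ℕ.≤-reflexive (≡.cong (k ℕ.+_) (≡.sym (ℕ.+-identityʳ k)))) (ℕ.n≤1+n _)
  open IsotropicSubgroup (isotropicSubgroup k k+k≤h)
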